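{- Let $n\geq 0$. The map sending a partial order $\preceq$ on $[n]$ to its incidence matrix $M_\preceq$ restricts to a bijection from the set of $\mathbf{3}$-free naturally labelled posets on $[n]$ onto the set of upper-triangular $n\times n$ binary matrices $M$ with every diagonal entry equal to $1$ that contain no partial submatrix $\begin{pmatrix}1&\ast\\ \mathbf{1}&1\end{pmatrix}$ whose lower-left entry lies on the main diagonal, i.e. for which there are no indices $i<j<k$ with $M(i,j)=1$ and $M(j,k)=1$ (the entry $M(i,k)$ being unrestricted).
   Context: A partial order $\preceq$ on $[n]$ is naturally labelled if $x\prec y$ implies $x<y$. It is $\mathbf{3}$-free if there are no three elements $x\prec y\prec z$. The incidence matrix of $\preceq$ is the $n\times n$ binary matrix $M_\preceq$ with $M_\preceq(i,j)=1$ iff $i\preceq j$. -}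

module Defs where

open import Data.Nat using (ℕ)
open import Data.Fin using (Fin; _<_)
open import Data.Bool using (Bool; true; false)
open import Data.Vec using (Vec; lookup; tabulate)
open import Data.Product using (_×_; ∃-syntax)
open import Relation.Nullary using (¬_; Dec)
open import Relation.Nullary.Decidable using (⌊_⌋)
open import Relation.Binary.PropositionalEquality using (_≡_; _≢_)
open import Relation.Binary.Definitions using (Decidable)
open import Relation.Binary.Structures using (IsPartialOrder)

record Poset (n : ℕ) : Set₁ where
  field
    _≼_ : Fin n → Fin n → Set
    isPartialOrder : IsPartialOrder _≡_ _≼_
    _≼?_ : Decidable _≼_

  _≺_ : Fin n → Fin n → Set
  x ≺ y = x ≼ y × x ≢ y

open Poset public

NaturallyLabelled : ∀ {n} → Poset n → Set
NaturallyLabelled P = ∀ x y → _≺_ P x y → x < y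

ThreeFree : ∀ {n} → Poset n → Set
ThreeFree P = ¬ (∃[ x ] ∃[ y ] ∃[ z ] (_≺_ P x y × _≺_ P y z))

Matrix : ℕ → Set
Matrix n = Vec (Vec Bool n) n

entry : ∀ {n} → Matrix n → Fin n → Fin n → Bool
entry M i j = lookup (lookup M i) j

incidence : ∀ {n} → Poset n → Matrix n
incidence P = tabulate λ i → tabulate λ j → ⌊ _≼?_ P i j ⌋

UpperTriangular : ∀ {n} → Matrix n → Set
UpperTriangular M = ∀ i j → j < i → entry M i j ≡ false

DiagonalOnes : ∀ {n} → Matrix n → Set
DiagonalOnes M = ∀ i → entry M i i ≡ true

AvoidsPattern : ∀ {n} → Matrix n → Set
AvoidsPattern M = ¬ (∃[ i ] ∃[ j ] ∃[ k ]
  (i < j × j < k × entry M i j ≡ true × entry M j k ≡ true))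

TargetMatrix : ∀ {n} → Matrix n → Set
TargetMatrix M = UpperTriangular M × DiagonalOnes M × AvoidsPattern M

Good : ∀ {n} → Poset n → Set
Good P = ThreeFree P × NaturallyLabelled P

SamePoset : ∀ {n} → Poset n → Poset n → Set
SamePoset P Q = ∀ i j → (_≼_ P i j → _≼_ Q i j) × (_≼_ Q i j → _≼_ P i j)

{-# OPTIONS --safe #-}
-- The incidence matrix of a naturally labelled poset is upper unitriangular, and a
-- chain i ≺ j ≺ k is exactly a forbidden pattern M(i,j) = M(j,k) = 1 with i < j < k.
-- Conversely, for such a matrix the relation M(i,j) = 1 is reflexive (diagonal),
-- antisymmetric (upper-triangular) and transitive, because a composable pair of
-- off-diagonal ones would form the forbidden pattern.
module Submission where

open import Defs
open import Data.Nat using (ℕ)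
open import Data.Fin using (Fin; _<_) renaming (_≟_ to _≟ᶠ_)
open import Data.Fin.Properties using (<-cmp; <-asym; <⇒≢)
open import Data.Bool using (true; false)
open import Data.Bool.Properties using (T-≡; ¬-not) renaming (_≟_ to _≟ᵇ_)
open import Data.Vec using (lookup; tabulate)
open import Data.Vec.Properties using (lookup∘tabulate; tabulate∘lookup; tabulate-cong)
open import Data.Product using (_×_; Σ-syntax; _,_)
open import Data.Empty using (⊥-elim)
open import Function.Bundles using (Equivalence)
open import Relation.Nullary using (yes; no)
open import Relation.Nullary.Decidable using (⌊_⌋; toWitness; fromWitness)
open import Relation.Binary.Definitions using (tri<; tri≈; tri>)
open import Relation.Binary.Structures using (IsPartialOrder)
open import Relation.Binary.PropositionalEquality
  using (_≡_; _≢_; refl; sym; trans; cong; ≢-sym; isEquivalence; module ≡-Reasoning)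

private
  variable
    n : ℕ

entry-incidence : (P : Poset n) (i j : Fin n) → entry (incidence P) i j ≡ ⌊ _≼?_ P i j ⌋
entry-incidence P i j =
  trans (cong (λ row → lookup row j) (lookup∘tabulate _ i)) (lookup∘tabulate _ j)

≼⇒incidence-true : (P : Poset n) {i j : Fin n} → _≼_ P i j → entry (incidence P) i j ≡ true
≼⇒incidence-true P {i} {j} i≼j =
  trans (entry-incidence P i j) (Equivalence.to T-≡ (fromWitness i≼j))

incidence-true⇒≼ : (P : Poset n) {i j : Fin n} → entry (incidence P) i j ≡ true → _≼_ P i j
incidence-true⇒≼ P {i} {j} e =
  toWitness (Equivalence.from T-≡ (trans (sym (entry-incidence P i j)) e))

incidence-≡ : (P : Poset n) (M : Matrix n) →
  (∀ i j → ⌊ _≼?_ P i j ⌋ ≡ entry M i j) → incidence P ≡ M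
incidence-≡ P M same = begin
  incidence P                            ≡⟨ tabulate-cong (λ i → tabulate-cong (same i)) ⟩
  tabulate (λ i → tabulate (entry M i))  ≡⟨ tabulate-cong (λ i → tabulate∘lookup (lookup M i)) ⟩
  tabulate (lookup M)                    ≡⟨ tabulate∘lookup M ⟩
  M                                      ∎
  where open ≡-Reasoning

incidence-upperTriangular : (P : Poset n) → NaturallyLabelled P → UpperTriangular (incidence P)
incidence-upperTriangular P natural i j j<i =
  ¬-not (λ e → <-asym j<i (natural i j (incidence-true⇒≼ P e , ≢-sym (<⇒≢ j<i))))

incidence-diagonalOnes : (P : Poset n) → DiagonalOnes (incidence P)
incidence-diagonalOnes P i = ≼⇒incidence-true P (IsPartialOrder.refl (isPartialOrder P))

incidence-avoidsPattern : (P : Poset n) → ThreeFree P → AvoidsPattern (incidence P)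
incidence-avoidsPattern P threeFree (i , j , k , i<j , j<k , eᵢⱼ , eⱼₖ) =
  threeFree (i , j , k , (incidence-true⇒≼ P eᵢⱼ , <⇒≢ i<j) , (incidence-true⇒≼ P eⱼₖ , <⇒≢ j<k))

incidence-injective : (P Q : Poset n) → incidence P ≡ incidence Q → SamePoset P Q
incidence-injective P Q P≡Q i j =
  (λ p → incidence-true⇒≼ Q (trans (sym (entryᵢⱼ P≡Q)) (≼⇒incidence-true P p))) ,
  (λ q → incidence-true⇒≼ P (trans (entryᵢⱼ P≡Q) (≼⇒incidence-true Q q)))
  where
  entryᵢⱼ = cong (λ M → entry M i j)

module _ (M : Matrix n) (upper : UpperTriangular M) where

  upperTriangular-one⇒< : ∀ {i j} → entry M i j ≡ true → i ≢ j → i < j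
  upperTriangular-one⇒< {i} {j} eᵢⱼ i≢j with <-cmp i j
  ... | tri< i<j _ _ = i<j
  ... | tri≈ _ i≡j _ = ⊥-elim (i≢j i≡j)
  ... | tri> _ _ j<i with trans (sym eᵢⱼ) (upper i j j<i)
  ...   | ()

  upperTriangular-antisym : ∀ {i j} → entry M i j ≡ true → entry M j i ≡ true → i ≡ j
  upperTriangular-antisym {i} {j} eᵢⱼ eⱼᵢ with i ≟ᶠ j
  ... | yes i≡j = i≡j
  ... | no i≢j  = ⊥-elim (<-asym (upperTriangular-one⇒< eᵢⱼ i≢j)
                                 (upperTriangular-one⇒< eⱼᵢ (≢-sym i≢j)))

  avoidsPattern⇒trans : AvoidsPattern M →
    ∀ {i j k} → entry M i j ≡ true → entry M j k ≡ true → entry M i k ≡ true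
  avoidsPattern⇒trans avoids {i} {j} {k} eᵢⱼ eⱼₖ with i ≟ᶠ j | j ≟ᶠ k
  ... | yes refl | _        = eⱼₖ
  ... | no _     | yes refl = eᵢⱼ
  ... | no i≢j   | no j≢k   = ⊥-elim (avoids (i , j , k , upperTriangular-one⇒< eᵢⱼ i≢j ,
                                              upperTriangular-one⇒< eⱼₖ j≢k , eᵢⱼ , eⱼₖ))

module _ (M : Matrix n) (upper : UpperTriangular M) (diagonal : DiagonalOnes M)
         (avoids : AvoidsPattern M) where

  matrixPoset : Poset n
  matrixPoset = record
    { _≼_ = λ i j → entry M i j ≡ true
    ; isPartialOrder = record
      { isPreorder = record
        { isEquivalence = isEquivalence
        ; reflexive = λ { {i} refl → diagonal i }
        ; trans = avoidsPattern⇒trans M upper avoids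
        }
      ; antisym = upperTriangular-antisym M upper
      }
    ; _≼?_ = λ i j → entry M i j ≟ᵇ true
    }

  matrixPoset-good : Good matrixPoset
  matrixPoset-good =
    (λ (i , j , k , (eᵢⱼ , i≢j) , (eⱼₖ , j≢k)) →
      avoids (i , j , k , upperTriangular-one⇒< M upper eᵢⱼ i≢j ,
              upperTriangular-one⇒< M upper eⱼₖ j≢k , eᵢⱼ , eⱼₖ)) ,
    (λ i j (eᵢⱼ , i≢j) → upperTriangular-one⇒< M upper eᵢⱼ i≢j)

  incidence-matrixPoset : incidence matrixPoset ≡ M
  incidence-matrixPoset = incidence-≡ matrixPoset M (λ i j → ⌊≟true⌋ (entry M i j))
    where
    ⌊≟true⌋ : ∀ b → ⌊ b ≟ᵇ true ⌋ ≡ b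
    ⌊≟true⌋ true  = refl
    ⌊≟true⌋ false = refl

proposition2p1 : (n : ℕ) →
    ((P : Poset n) → Good P → TargetMatrix (incidence P))
    × ((P Q : Poset n) → Good P → Good Q → incidence P ≡ incidence Q → SamePoset P Q)
    × ((M : Matrix n) → TargetMatrix M → Σ[ P ∈ Poset n ] (Good P × incidence P ≡ M))
proposition2p1 n =
  (λ P (threeFree , natural) →
     incidence-upperTriangular P natural ,
     incidence-diagonalOnes P ,
     incidence-avoidsPattern P threeFree) ,
  (λ P Q _ _ → incidence-injective P Q) ,
  (λ M (upper , diagonal , avoids) →
     matrixPoset M upper diagonal avoids ,
     matrixPoset-good M upper diagonal avoids ,
     incidence-matrixPoset M upper diagonal avoids)
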